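{- Let $G=(V,E)$ be a finite simple graph and let $u,w\in V$ be distinct vertices with $N(w)=N(u)$. Then \[ D(G,x)=x\,D(G/u,x)+D(G-u,x)-x\,D(G-N[u]-w,x). \]
   Context: The domination polynomial of $G=(V,E)$ is $D(G,x)=\sum_{W\subseteq V,\ N_G[W]=V}x^{|W|}$, where $N_G[W]$ is the closed neighborhood of $W$; the graph with no vertices has $D=1$. $N(u)$ and $N[u]$ are the open and closed neighborhoods of $u$ in $G$. Graph operations: - $G-u$ deletes $u$. - $G/u$ deletes $u$ and adds edges between all pairs of non-adjacent neighbors of $u$. - $G-N[u]-w$ deletes all vertices of $N[u]$ and the vertex $w$. -}

module Defs where

open import Data.Bool using (Bool; true; false; _∧_; _∨_; not; if_then_else_)
open import Data.Nat using (ℕ; zero; suc)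
open import Data.Fin using (Fin; _≟_)
open import Data.Fin.Subset using (Subset; ∣_∣)
open import Data.Vec using (Vec; []; _∷_; lookup; tabulate)
open import Data.List using (List; []; _∷_; map; _++_; allFin; filter; length; foldr)
open import Data.Integer using (ℤ; +_; _+_; _-_)
open import Relation.Nullary.Decidable using (⌊_⌋)
open import Relation.Binary.PropositionalEquality using (_≡_)
import Data.Nat as ℕ

-- A graph whose vertex set is a subset V of Fin n, with adjacency relation
-- adj (only consulted on vertices of V).  Simplicity (symmetric, irreflexive)
-- is imposed as a hypothesis in the theorem.
record Graph (n : ℕ) : Set where
  constructor mkGraph
  field
    V   : Subset n
    adj : Fin n → Fin n → Bool
open Graph public

allB : ∀ {n} → (Fin n → Bool) → Bool
allB {n} p = foldr (λ i b → p i ∧ b) true (allFin n)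

anyB : ∀ {n} → (Fin n → Bool) → Bool
anyB {n} p = foldr (λ i b → p i ∨ b) false (allFin n)

_∈B_ : ∀ {n} → Fin n → Subset n → Bool
i ∈B S = lookup S i

eqB : ∀ {n} → Fin n → Fin n → Bool
eqB i j = ⌊ i ≟ j ⌋

allSubsets : ∀ n → List (Subset n)
allSubsets zero = [] ∷ []
allSubsets (suc n) = map (true ∷_) (allSubsets n) ++ map (false ∷_) (allSubsets n)

isDominating : ∀ {n} → Graph n → Subset n → Bool
isDominating G W =
  allB (λ i → not (i ∈B W) ∨ (i ∈B V G)) ∧
  allB (λ v → not (v ∈B V G) ∨ (v ∈B W ∨ anyB (λ w → (w ∈B W) ∧ adj G w v)))

Poly : Set
Poly = ℕ → ℤ

_+P_ : Poly → Poly → Poly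
(p +P q) k = p k + q k

_-P_ : Poly → Poly → Poly
(p -P q) k = p k - q k

X* : Poly → Poly
X* p zero = + 0
X* p (suc k) = p k

_≈P_ : Poly → Poly → Set
p ≈P q = ∀ k → p k ≡ q k

countB : ∀ {A : Set} → (A → Bool) → List A → ℕ
countB p [] = 0
countB p (x ∷ xs) = if p x then suc (countB p xs) else countB p xs

D : ∀ {n} → Graph n → Poly
D {n} G k = + countB (λ W → isDominating G W ∧ ⌊ ∣ W ∣ ℕ.≟ k ⌋) (allSubsets n)

delete : ∀ {n} → Graph n → Fin n → Graph n
delete G u = mkGraph (tabulate (λ i → (i ∈B V G) ∧ not (eqB i u))) (adj G)

contract : ∀ {n} → Graph n → Fin n → Graph n
contract G u = mkGraph (tabulate (λ i → (i ∈B V G) ∧ not (eqB i u)))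
  (λ x y → adj G x y ∨ (adj G u x ∧ adj G u y ∧ not (eqB x y)))

deleteClosedNbhdAnd : ∀ {n} → Graph n → Fin n → Fin n → Graph n
deleteClosedNbhdAnd G u w =
  mkGraph (tabulate (λ i → (i ∈B V G) ∧ not (eqB i u) ∧ not (adj G u i) ∧ not (eqB i w))) (adj G)

-- Write A_k for the number of dominating sets of G of size k that avoid u.
-- Splitting the dominating sets of G on whether they contain u gives
--   [x^k] D(G) = [x^k] x·D(G/u) + A_k,
-- because S ∪ {u} dominates G (u ∉ S) exactly when S dominates G/u.
-- Splitting the dominating sets W of G−u on whether W meets N(u) gives
--   [x^k] D(G−u) = A_k + [x^k] x·D(G−N[u]−w):
-- if W meets N(u), W dominates G−u iff it dominates G (and avoids u);
-- if not, the twin w can only be dominated by itself, so W = T ∪ {w}, and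
-- T ∪ {w} dominates G−u iff T dominates G−N[u]−w.
-- Subtracting the two identities gives the theorem.
module Submission where

open import Defs
open import Data.Bool using (Bool; true; false; _∧_; _∨_; not; T)
open import Data.Bool.Properties using (T-∧; T-∨; ∧-assoc; ∧-zeroʳ)
open import Data.Empty using (⊥-elim)
open import Data.Fin using (Fin; zero; suc) renaming (_≟_ to _≟ᶠ_)
open import Data.Fin.Subset using (Subset; ∣_∣)
open import Data.Integer using (+_; _+_; _-_)
open import Data.Integer.Properties using (pos-+)
open import Data.Integer.Solver using (module +-*-Solver)
open import Data.List using ([]; _∷_; map; _++_; foldr; allFin)
open import Data.List.Membership.Propositional using (lose)
open import Data.List.Membership.Propositional.Properties using (∈-allFin)
open import Data.List.Relation.Unary.All using (All; []; _∷_) renaming (lookup to All-lookup; tabulate to All-tabulate)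
open import Data.List.Relation.Unary.Any using (Any; here; there; satisfied)
open import Data.Nat using (ℕ; zero; suc) renaming (_+_ to _+ℕ_; _≟_ to _≟ℕ_)
open import Data.Nat.Properties using (+-comm; +-suc; suc-injective)
open import Data.Product using (_×_; _,_; proj₁; proj₂; ∃-syntax)
open import Data.Sum using (_⊎_; inj₁; inj₂)
open import Data.Unit using (tt)
open import Data.Vec using (_∷_; lookup; replicate; tabulate; _[_]≔_)
open import Data.Vec.Properties using (lookup-replicate; lookup∘tabulate; lookup∘update; lookup∘update′)
open import Function using (_∘_; _⇔_; mk⇔; Equivalence)
open import Function.Properties.Equivalence using () renaming (trans to ⇔-trans)
open import Data.Product.Function.NonDependent.Propositional using (_×-⇔_)
open import Relation.Nullary using (¬_; yes; no)
open import Relation.Nullary.Decidable using (⌊_⌋; T?; toWitness; fromWitness; toWitnessFalse; fromWitnessFalse)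
open import Relation.Binary.PropositionalEquality

open Equivalence using (to; from)

T-injective : ∀ {a b : Bool} → (T a → T b) → (T b → T a) → a ≡ b
T-injective {false} {false} _ _ = refl
T-injective {false} {true}  _ g = ⊥-elim (g tt)
T-injective {true}  {false} f _ = ⊥-elim (f tt)
T-injective {true}  {true}  _ _ = refl

∧-absorb : ∀ {a b : Bool} → (T a → T b) → a ≡ b ∧ a
∧-absorb {a} {b} f = T-injective (λ ta → from (T-∧ {b} {a}) (f ta , ta)) (proj₂ ∘ to (T-∧ {b} {a}))

T-not : ∀ {a : Bool} → T (not a) ⇔ (¬ T a)
T-not {false} = mk⇔ (λ _ ()) (λ _ → tt)
T-not {true}  = mk⇔ (λ ()) (λ f → f tt)

T-implies : ∀ {a b : Bool} → T (not a ∨ b) ⇔ (T a → T b)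
T-implies {false} = mk⇔ (λ _ ()) (λ _ → tt)
T-implies {true}  = mk⇔ (λ tb _ → tb) (λ f → f tt)

T-fold-∧ : ∀ {A : Set} (p : A → Bool) xs →
  T (foldr (λ x b → p x ∧ b) true xs) ⇔ All (T ∘ p) xs
T-fold-∧ p []       = mk⇔ (λ _ → []) (λ _ → tt)
T-fold-∧ p (x ∷ xs) = mk⇔
  (λ h → let (px , rest) = to T-∧ h in px ∷ to (T-fold-∧ p xs) rest)
  (λ { (px ∷ rest) → from T-∧ (px , from (T-fold-∧ p xs) rest) })

T-fold-∨ : ∀ {A : Set} (p : A → Bool) xs →
  T (foldr (λ x b → p x ∨ b) false xs) ⇔ Any (T ∘ p) xs
T-fold-∨ p []       = mk⇔ (λ ()) (λ ())
T-fold-∨ p (x ∷ xs) = mk⇔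
  (λ h → case-∨ (to (T-∨ {p x}) h))
  (λ { (here px) → from T-∨ (inj₁ px) ; (there rest) → from (T-∨ {p x}) (inj₂ (from (T-fold-∨ p xs) rest)) })
  where
  case-∨ : T (p x) ⊎ T (foldr (λ x b → p x ∨ b) false xs) → Any (T ∘ p) (x ∷ xs)
  case-∨ (inj₁ px)   = here px
  case-∨ (inj₂ rest) = there (to (T-fold-∨ p xs) rest)

T-allB : ∀ {n} {p : Fin n → Bool} → T (allB p) ⇔ (∀ i → T (p i))
T-allB {n} {p} = mk⇔
  (λ h i → All-lookup (to (T-fold-∧ p (allFin n)) h) (∈-allFin i))
  (λ h → from (T-fold-∧ p (allFin n)) (All-tabulate (λ {i} _ → h i)))

T-anyB : ∀ {n} {p : Fin n → Bool} → T (anyB p) ⇔ (∃[ i ] T (p i))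
T-anyB {n} {p} = mk⇔
  (λ h → satisfied (to (T-fold-∨ p (allFin n)) h))
  (λ (i , pi) → from (T-fold-∨ p (allFin n)) (lose (∈-allFin i) pi))

T-neq : ∀ {n} {i j : Fin n} → T (not (eqB i j)) ⇔ (i ≢ j)
T-neq = mk⇔ toWitnessFalse fromWitnessFalse

reflects-≡ : ∀ {a b : Bool} {A B : Set} → T a ⇔ A → T b ⇔ B → A ⇔ B → a ≡ b
reflects-≡ ra rb e = T-injective (from rb ∘ to e ∘ to ra) (from ra ∘ from e ∘ to rb)

T-∧-reflects : ∀ {a b : Bool} {A B : Set} → T a ⇔ A → T b ⇔ B → T (a ∧ b) ⇔ (A × B)
T-∧-reflects {a} ra rb = ⇔-trans (T-∧ {a}) (ra ×-⇔ rb)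

countB-cong : ∀ {A : Set} {p q : A → Bool} → (∀ x → p x ≡ q x) → ∀ xs → countB p xs ≡ countB q xs
countB-cong h []       = refl
countB-cong {p = p} {q} h (x ∷ xs) with p x | q x | h x
... | true  | .true  | refl = cong suc (countB-cong h xs)
... | false | .false | refl = countB-cong h xs

countB-none : ∀ {A : Set} {p : A → Bool} → (∀ x → p x ≡ false) → ∀ xs → countB p xs ≡ 0
countB-none h []       = refl
countB-none {p = p} h (x ∷ xs) rewrite h x = countB-none h xs

countB-++ : ∀ {A : Set} (p : A → Bool) xs ys → countB p (xs ++ ys) ≡ countB p xs +ℕ countB p ys
countB-++ p []       ys = refl
countB-++ p (x ∷ xs) ys with p x
... | true  = cong suc (countB-++ p xs ys)
... | false = countB-++ p xs ys

countB-map : ∀ {A B : Set} (p : B → Bool) (f : A → B) xs → countB p (map f xs) ≡ countB (p ∘ f) xs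
countB-map p f []       = refl
countB-map p f (x ∷ xs) with p (f x)
... | true  = cong suc (countB-map p f xs)
... | false = countB-map p f xs

countB-split : ∀ {A : Set} (q p : A → Bool) xs →
  countB p xs ≡ countB (λ x → q x ∧ p x) xs +ℕ countB (λ x → not (q x) ∧ p x) xs
countB-split q p []       = refl
countB-split q p (x ∷ xs) with q x | p x
... | true  | true  = cong suc (countB-split q p xs)
... | true  | false = countB-split q p xs
... | false | true  = trans (cong suc (countB-split q p xs)) (sym (+-suc _ _))
... | false | false = countB-split q p xs

countB-allSubsets-suc : ∀ {n} (p : Subset (suc n) → Bool) →
  countB p (allSubsets (suc n))
  ≡ countB (λ S → p (true ∷ S)) (allSubsets n) +ℕ countB (λ S → p (false ∷ S)) (allSubsets n)
countB-allSubsets-suc {n} p = trans (countB-++ p (map (true ∷_) (allSubsets n)) _)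
  (cong₂ _+ℕ_ (countB-map p (true ∷_) (allSubsets n)) (countB-map p (false ∷_) (allSubsets n)))

-- Inserting u is a bijection from the subsets avoiding u onto those
-- containing u, raising the size by one: for any predicate P on subsets
-- and f on sizes,
--   #{W ∋ u | P W ∧ f ∣W∣} = #{S ∌ u | P (S ∪ {u}) ∧ f (∣S∣ + 1)}.
countB-insert : ∀ {n} (u : Fin n) (P : Subset n → Bool) (f : ℕ → Bool) →
  countB (λ W → lookup W u ∧ (P W ∧ f ∣ W ∣)) (allSubsets n)
  ≡ countB (λ S → not (lookup S u) ∧ (P (S [ u ]≔ true) ∧ f (suc ∣ S ∣))) (allSubsets n)
countB-insert {suc n} zero P f = begin
    countB (λ W → lookup W zero ∧ (P W ∧ f ∣ W ∣)) (allSubsets (suc n))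
  ≡⟨ countB-allSubsets-suc {n} (λ W → lookup W zero ∧ (P W ∧ f ∣ W ∣)) ⟩
    countB inserted A +ℕ countB (λ _ → false) A
  ≡⟨ cong (countB inserted A +ℕ_) (countB-none (λ _ → refl) A) ⟩
    countB inserted A +ℕ 0
  ≡⟨ +-comm _ 0 ⟩
    0 +ℕ countB inserted A
  ≡⟨ cong (_+ℕ countB inserted A) (sym (countB-none (λ _ → refl) A)) ⟩
    countB (λ _ → false) A +ℕ countB inserted A
  ≡⟨ sym (countB-allSubsets-suc {n} (λ S → not (lookup S zero) ∧ (P (S [ zero ]≔ true) ∧ f (suc ∣ S ∣)))) ⟩
    countB (λ S → not (lookup S zero) ∧ (P (S [ zero ]≔ true) ∧ f (suc ∣ S ∣))) (allSubsets (suc n))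
  ∎
  where
  open ≡-Reasoning
  A = allSubsets n
  inserted : Subset n → Bool
  inserted S = P (true ∷ S) ∧ f (suc ∣ S ∣)
countB-insert {suc n} (suc u) P f = begin
    countB (λ W → lookup W (suc u) ∧ (P W ∧ f ∣ W ∣)) (allSubsets (suc n))
  ≡⟨ countB-allSubsets-suc {n} (λ W → lookup W (suc u) ∧ (P W ∧ f ∣ W ∣)) ⟩
    countB (λ W → lookup W u ∧ (P (true ∷ W) ∧ f (suc ∣ W ∣))) A
      +ℕ countB (λ W → lookup W u ∧ (P (false ∷ W) ∧ f ∣ W ∣)) A
  ≡⟨ cong₂ _+ℕ_ (countB-insert u (λ S → P (true ∷ S)) (f ∘ suc))
                (countB-insert u (λ S → P (false ∷ S)) f) ⟩
    countB (λ S → not (lookup S u) ∧ (P (true ∷ (S [ u ]≔ true)) ∧ f (suc (suc ∣ S ∣)))) A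
      +ℕ countB (λ S → not (lookup S u) ∧ (P (false ∷ (S [ u ]≔ true)) ∧ f (suc ∣ S ∣))) A
  ≡⟨ sym (countB-allSubsets-suc {n} (λ S → not (lookup S (suc u)) ∧ (P (S [ suc u ]≔ true) ∧ f (suc ∣ S ∣)))) ⟩
    countB (λ S → not (lookup S (suc u)) ∧ (P (S [ suc u ]≔ true) ∧ f (suc ∣ S ∣))) (allSubsets (suc n))
  ∎
  where
  open ≡-Reasoning
  A = allSubsets n

X*ℕ : (ℕ → ℕ) → ℕ → ℕ
X*ℕ c zero    = 0
X*ℕ c (suc k) = c k

X*ℕ-cong : ∀ {c d : ℕ → ℕ} → (∀ j → c j ≡ d j) → ∀ k → X*ℕ c k ≡ X*ℕ d k
X*ℕ-cong h zero    = refl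
X*ℕ-cong h (suc k) = h k

X*-pos : ∀ (c : ℕ → ℕ) k → X* (λ j → + c j) k ≡ + X*ℕ c k
X*-pos c zero    = refl
X*-pos c (suc k) = refl

hasSize : ∀ {n} → ℕ → Subset n → Bool
hasSize k W = ⌊ ∣ W ∣ ≟ℕ k ⌋

≟-suc : ∀ m k → ⌊ suc m ≟ℕ suc k ⌋ ≡ ⌊ m ≟ℕ k ⌋
≟-suc m k = T-injective
  (λ t → fromWitness (suc-injective (toWitness t)))
  (λ t → fromWitness (cong suc (toWitness t)))

-- The number of k-element subsets of Fin n satisfying P; by definition
-- D G k = + sizedCount (isDominating G) k.
sizedCount : ∀ {n} → (Subset n → Bool) → ℕ → ℕ
sizedCount {n} P k = countB (λ W → P W ∧ hasSize k W) (allSubsets n)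

sizedCount-cong : ∀ {n} {P Q : Subset n → Bool} → (∀ W → P W ≡ Q W) → ∀ k → sizedCount P k ≡ sizedCount Q k
sizedCount-cong {n} h k = countB-cong (λ W → cong (_∧ hasSize k W) (h W)) (allSubsets n)

sizedCount-split : ∀ {n} (q P : Subset n → Bool) k →
  sizedCount P k ≡ sizedCount (λ W → q W ∧ P W) k +ℕ sizedCount (λ W → not (q W) ∧ P W) k
sizedCount-split {n} q P k = trans (countB-split q (λ W → P W ∧ hasSize k W) (allSubsets n))
  (cong₂ _+ℕ_ (countB-cong (λ W → sym (∧-assoc (q W) (P W) _)) (allSubsets n))
              (countB-cong (λ W → sym (∧-assoc (not (q W)) (P W) _)) (allSubsets n)))

sizedCount-insert : ∀ {n} (u : Fin n) (P : Subset n → Bool) k →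
  sizedCount (λ W → lookup W u ∧ P W) k
  ≡ X*ℕ (sizedCount (λ S → not (lookup S u) ∧ P (S [ u ]≔ true))) k
sizedCount-insert {n} u P k =
  trans (countB-cong (λ W → ∧-assoc (lookup W u) (P W) _) (allSubsets n))
  (trans (countB-insert u P (λ m → ⌊ m ≟ℕ k ⌋)) (sizes k))
  where
  sizes : ∀ k → countB (λ S → not (lookup S u) ∧ (P (S [ u ]≔ true) ∧ ⌊ suc ∣ S ∣ ≟ℕ k ⌋)) (allSubsets n)
                ≡ X*ℕ (sizedCount (λ S → not (lookup S u) ∧ P (S [ u ]≔ true))) k
  sizes zero    = countB-none
    (λ S → trans (cong (not (lookup S u) ∧_) (∧-zeroʳ (P (S [ u ]≔ true)))) (∧-zeroʳ _)) (allSubsets n)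
  sizes (suc j) = countB-cong
    (λ S → trans (cong (λ b → not (lookup S u) ∧ (P (S [ u ]≔ true) ∧ b)) (≟-suc ∣ S ∣ j))
                 (sym (∧-assoc (not (lookup S u)) _ _))) (allSubsets n)

_∈ₛ_ : ∀ {n} → Fin n → Subset n → Set
i ∈ₛ S = T (i ∈B S)

_∉ₛ_ : ∀ {n} → Fin n → Subset n → Set
i ∉ₛ S = ¬ (i ∈ₛ S)

Covers : ∀ {n} → Graph n → Subset n → Fin n → Set
Covers G W v = v ∈ₛ W ⊎ ∃[ s ] (s ∈ₛ W × T (adj G s v))

Dominates : ∀ {n} → Graph n → Subset n → Set
Dominates G W = (∀ i → i ∈ₛ W → i ∈ₛ V G) × (∀ v → v ∈ₛ V G → Covers G W v)

dominates-reflects : ∀ {n} (G : Graph n) W → T (isDominating G W) ⇔ Dominates G W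
dominates-reflects {n} G W = mk⇔
  (λ h → let (inside , covered) = to (T-∧ {allB inVG}) h in
     (λ i → to T-implies (to T-allB inside i)) ,
     (λ v → covers v ∘ to (T-implies {v ∈B V G}) (to T-allB covered v)))
  (λ (sub , dom) → from T-∧
     ( from T-allB (λ i → from (T-implies {i ∈B W}) (sub i))
     , from T-allB (λ v → from (T-implies {v ∈B V G}) (covers⁻ v ∘ dom v))))
  where
  inVG : Fin n → Bool
  inVG i = not (i ∈B W) ∨ (i ∈B V G)
  coveredB : Fin n → Bool
  coveredB v = v ∈B W ∨ anyB (λ s → (s ∈B W) ∧ adj G s v)
  covers : ∀ v → T (coveredB v) → Covers G W v
  covers v h with to (T-∨ {v ∈B W}) h
  ... | inj₁ vW = inj₁ vW
  ... | inj₂ t  = let (s , st) = to T-anyB t in inj₂ (s , to (T-∧ {s ∈B W}) st)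
  covers⁻ : ∀ v → Covers G W v → T (coveredB v)
  covers⁻ v (inj₁ vW)            = from (T-∨ {v ∈B W}) (inj₁ vW)
  covers⁻ v (inj₂ (s , sW , asv)) = from (T-∨ {v ∈B W}) (inj₂ (from T-anyB (s , from (T-∧ {s ∈B W}) (sW , asv))))

∈-insert-self : ∀ {n} (S : Subset n) u → u ∈ₛ (S [ u ]≔ true)
∈-insert-self S u = subst T (sym (lookup∘update u S true)) tt

∈-insert-old : ∀ {n} (S : Subset n) u {i} → i ∈ₛ S → i ∈ₛ (S [ u ]≔ true)
∈-insert-old S u {i} iS with i ≟ᶠ u
... | yes refl = ∈-insert-self S u
... | no  i≢u  = subst T (sym (lookup∘update′ i≢u S true)) iS

∈-insert-cases : ∀ {n} (S : Subset n) u {i} → i ∈ₛ (S [ u ]≔ true) → i ≡ u ⊎ i ∈ₛ S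
∈-insert-cases S u {i} iS′ with i ≟ᶠ u
... | yes i≡u = inj₁ i≡u
... | no  i≢u = inj₂ (subst T (lookup∘update′ i≢u S true) iS′)

∈-insert-other : ∀ {n} (S : Subset n) u {i} → i ≢ u → i ∈ₛ (S [ u ]≔ true) → i ∈ₛ S
∈-insert-other S u i≢u iS′ with ∈-insert-cases S u iS′
... | inj₁ i≡u = ⊥-elim (i≢u i≡u)
... | inj₂ iS  = iS

module Twins {n : ℕ} (a : Fin n → Fin n → Bool)
  (symA : ∀ x y → a x y ≡ a y x) (irr : ∀ x → a x x ≡ false)
  (u w : Fin n) (u≢w : u ≢ w) (twin : ∀ v → a w v ≡ a u v) where

  G : Graph n
  G = mkGraph (replicate n true) a

  G-u G/u G-Nu-w : Graph n
  G-u    = delete G u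
  G/u    = contract G u
  G-Nu-w = deleteClosedNbhdAnd G u w

  meetsN : Subset n → Bool
  meetsN W = anyB (λ s → (s ∈B W) ∧ a u s)

  MeetsN : Subset n → Set
  MeetsN W = ∃[ s ] (s ∈ₛ W × T (a u s))

  meetsN-reflects : ∀ W → T (meetsN W) ⇔ MeetsN W
  meetsN-reflects W = mk⇔
    (λ t → let (s , st) = to T-anyB t in s , to (T-∧ {s ∈B W}) st)
    (λ (s , sW , aus) → from T-anyB (s , from (T-∧ {s ∈B W}) (sW , aus)))

  adj-sym : ∀ {x y} → T (a x y) → T (a y x)
  adj-sym {x} {y} = subst T (symA x y)

  via-twin : ∀ {v} → T (a w v) → T (a u v)
  via-twin {v} = subst T (twin v)

  -- u and w are not adjacent, since w ∉ N(w) = N(u).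
  u≁w : ¬ T (a u w)
  u≁w auw = subst T (irr u) (via-twin (adj-sym auw))

  w≢u : w ≢ u
  w≢u = u≢w ∘ sym

  in-G : ∀ i → i ∈ₛ V G
  in-G i = subst T (sym (lookup-replicate i true)) tt

  in-G-u : ∀ {i} → i ∈ₛ V G-u ⇔ (i ≢ u)
  in-G-u {i} = ⇔-trans (mk⇔ (subst T vertices) (subst T (sym vertices))) T-neq
    where
    vertices : lookup (V G-u) i ≡ not (eqB i u)
    vertices = trans (lookup∘tabulate _ i) (cong (_∧ not (eqB i u)) (lookup-replicate i true))

  in-G-Nu-w : ∀ {i} → i ∈ₛ V G-Nu-w ⇔ (i ≢ u × ¬ T (a u i) × i ≢ w)
  in-G-Nu-w {i} = ⇔-trans (mk⇔ (subst T vertices) (subst T (sym vertices)))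
                    (T-∧-reflects T-neq (T-∧-reflects T-not T-neq))
    where
    vertices : lookup (V G-Nu-w) i ≡ not (eqB i u) ∧ not (a u i) ∧ not (eqB i w)
    vertices = trans (lookup∘tabulate _ i)
      (cong (_∧ (not (eqB i u) ∧ not (a u i) ∧ not (eqB i w))) (lookup-replicate i true))

  not-meetsN-reflects : ∀ W → T (not (meetsN W)) ⇔ (¬ MeetsN W)
  not-meetsN-reflects W = mk⇔
    (λ t m → to T-not t (from (meetsN-reflects W) m))
    (λ ¬m → from T-not (¬m ∘ to (meetsN-reflects W)))

  -- (A) If W meets N(u), then u is dominated anyway: W dominates G − u
  -- iff it dominates G and avoids u.
  meeting-dominates : ∀ W → (MeetsN W × Dominates G-u W) ⇔ (u ∉ₛ W × Dominates G W)
  meeting-dominates W = mk⇔ forward backward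
    where
    forward : MeetsN W × Dominates G-u W → u ∉ₛ W × Dominates G W
    forward ((s , sW , aus) , sub , dom) = (λ uW → to in-G-u (sub u uW) refl) , (λ i _ → in-G i) , covers
      where
      covers : ∀ v → v ∈ₛ V G → Covers G W v
      covers v _ with v ≟ᶠ u
      ... | yes refl = inj₂ (s , sW , adj-sym aus)
      ... | no  v≢u  = dom v (from in-G-u v≢u)
    backward : u ∉ₛ W × Dominates G W → MeetsN W × Dominates G-u W
    backward (u∉W , sub , dom) =
      meets (dom u (in-G u)) , (λ i iW → from in-G-u (λ { refl → u∉W iW })) , (λ v _ → dom v (in-G v))
      where
      meets : Covers G W u → MeetsN W
      meets (inj₁ uW)             = ⊥-elim (u∉W uW)
      meets (inj₂ (s , sW , asu)) = s , sW , adj-sym asu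

  meeting-dominatesᵇ : ∀ W → meetsN W ∧ isDominating G-u W ≡ not (u ∈B W) ∧ isDominating G W
  meeting-dominatesᵇ W = reflects-≡ (T-∧-reflects (meetsN-reflects W) (dominates-reflects G-u W))
                                    (T-∧-reflects T-not (dominates-reflects G W)) (meeting-dominates W)

  -- A vertex v
  -- dominated only by u lies in N(u) = N(w); whatever dominates w is then
  -- v itself or a neighbour of u, hence adjacent to v in G/u.
  contract-dominates : ∀ S → (u ∉ₛ S × Dominates G (S [ u ]≔ true)) ⇔ Dominates G/u S
  contract-dominates S = mk⇔ forward backward
    where
    S′ = S [ u ]≔ true
    forward : u ∉ₛ S × Dominates G S′ → Dominates G/u S
    forward (u∉S , sub , dom) = (λ i iS → from in-G-u (λ { refl → u∉S iS })) , covers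
      where
      covers : ∀ v → v ∈ₛ V G/u → Covers G/u S v
      covers v vV with dom v (in-G v)
      ... | inj₁ vS′ = inj₁ (∈-insert-other S u (to in-G-u vV) vS′)
      ... | inj₂ (s , sS′ , asv) with s ≟ᶠ u
      ... | no  s≢u  = inj₂ (s , ∈-insert-other S u s≢u sS′ , from (T-∨ {a s v}) (inj₁ asv))
      ... | yes refl = through-w (dom w (in-G w))
        where
        through-w : Covers G S′ w → Covers G/u S v
        through-w (inj₁ wS′) =
          inj₂ (w , ∈-insert-other S u w≢u wS′ , from (T-∨ {a w v}) (inj₁ (subst T (sym (twin v)) asv)))
        through-w (inj₂ (t , tS′ , atw)) with t ≟ᶠ u | t ≟ᶠ v
        ... | yes refl | _        = ⊥-elim (u≁w atw)
        ... | no  t≢u  | yes refl = inj₁ (∈-insert-other S u t≢u tS′)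
        ... | no  t≢u  | no  t≢v  = inj₂ (t , ∈-insert-other S u t≢u tS′ , from (T-∨ {a t v})
                (inj₂ (from (T-∧ {a u t}) (via-twin (adj-sym atw) , from (T-∧ {a u v}) (asv , from T-neq t≢v)))))
    backward : Dominates G/u S → u ∉ₛ S × Dominates G S′
    backward (sub , dom) = (λ uS → to in-G-u (sub u uS) refl) , (λ i _ → in-G i) , covers
      where
      covers : ∀ v → v ∈ₛ V G → Covers G S′ v
      covers v _ with v ≟ᶠ u
      ... | yes refl = inj₁ (∈-insert-self S u)
      ... | no  v≢u  with dom v (from in-G-u v≢u)
      ... | inj₁ vS = inj₁ (∈-insert-old S u vS)
      ... | inj₂ (s , sS , c) with to (T-∨ {a s v}) c
      ... | inj₁ asv = inj₂ (s , ∈-insert-old S u sS , asv)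
      ... | inj₂ r   = inj₂ (u , ∈-insert-self S u , proj₁ (to (T-∧ {a u v}) (proj₂ (to (T-∧ {a u s}) r))))

  contract-dominatesᵇ : ∀ S → not (u ∈B S) ∧ isDominating G (S [ u ]≔ true) ≡ isDominating G/u S
  contract-dominatesᵇ S = reflects-≡ (T-∧-reflects T-not (dominates-reflects G (S [ u ]≔ true)))
                                     (dominates-reflects G/u S) (contract-dominates S)

  -- (C) If W dominates G − u but misses N(u), the twin w, whose neighbours
  -- all lie in N(u), must itself be in W.
  missing-contains-twin : ∀ W → ¬ MeetsN W → Dominates G-u W → w ∈ₛ W
  missing-contains-twin W miss (_ , dom) with dom w (from in-G-u w≢u)
  ... | inj₁ wW             = wW
  ... | inj₂ (s , sW , asw) = ⊥-elim (miss (s , sW , via-twin (adj-sym asw)))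

  missing-contains-twinᵇ : ∀ W →
    not (meetsN W) ∧ isDominating G-u W ≡ (w ∈B W) ∧ (not (meetsN W) ∧ isDominating G-u W)
  missing-contains-twinᵇ W = ∧-absorb λ t →
    let (miss , dom) = to (T-∧-reflects (not-meetsN-reflects W) (dominates-reflects G-u W)) t
    in missing-contains-twin W miss dom

  -- (D) For R ∌ w: R ∪ {w} dominates G − u without meeting N(u) iff R
  -- dominates G − N[u] − w; the vertex w and the set N(u) = N(w) are
  -- exactly what w dominates.
  twin-dominates : ∀ R →
    (w ∉ₛ R × ¬ MeetsN (R [ w ]≔ true) × Dominates G-u (R [ w ]≔ true)) ⇔ Dominates G-Nu-w R
  twin-dominates R = mk⇔ forward backward
    where
    R′ = R [ w ]≔ true
    forward : w ∉ₛ R × ¬ MeetsN R′ × Dominates G-u R′ → Dominates G-Nu-w R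
    forward (w∉R , miss , sub , dom) = inside , covers
      where
      inside : ∀ i → i ∈ₛ R → i ∈ₛ V G-Nu-w
      inside i iR = from in-G-Nu-w (to in-G-u (sub i (∈-insert-old R w iR)) ,
                                    (λ aui → miss (i , ∈-insert-old R w iR , aui)) , (λ { refl → w∉R iR }))
      covers : ∀ v → v ∈ₛ V G-Nu-w → Covers G-Nu-w R v
      covers v vV with to in-G-Nu-w vV
      ... | v≢u , u≁v , v≢w with dom v (from in-G-u v≢u)
      ... | inj₁ vR′ = inj₁ (∈-insert-other R w v≢w vR′)
      ... | inj₂ (s , sR′ , asv) with s ≟ᶠ w
      ... | yes refl = ⊥-elim (u≁v (via-twin asv))
      ... | no  s≢w  = inj₂ (s , ∈-insert-other R w s≢w sR′ , asv)
    backward : Dominates G-Nu-w R → w ∉ₛ R × ¬ MeetsN R′ × Dominates G-u R′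
    backward (sub , dom) = (λ wR → proj₂ (proj₂ (to in-G-Nu-w (sub w wR))) refl) , miss , inside , covers
      where
      miss : ¬ MeetsN R′
      miss (s , sR′ , aus) with ∈-insert-cases R w sR′
      ... | inj₁ refl = u≁w aus
      ... | inj₂ sR   = proj₁ (proj₂ (to in-G-Nu-w (sub s sR))) aus
      inside : ∀ i → i ∈ₛ R′ → i ∈ₛ V G-u
      inside i iR′ with ∈-insert-cases R w iR′
      ... | inj₁ refl = from in-G-u w≢u
      ... | inj₂ iR   = from in-G-u (proj₁ (to in-G-Nu-w (sub i iR)))
      covers : ∀ v → v ∈ₛ V G-u → Covers G-u R′ v
      covers v vV with v ≟ᶠ w
      ... | yes refl = inj₁ (∈-insert-self R w)
      ... | no  v≢w  with T? (a u v)
      ... | yes auv = inj₂ (w , ∈-insert-self R w , subst T (sym (twin v)) auv)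
      ... | no  u≁v with dom v (from in-G-Nu-w (to in-G-u vV , u≁v , v≢w))
      ... | inj₁ vR             = inj₁ (∈-insert-old R w vR)
      ... | inj₂ (s , sR , asv) = inj₂ (s , ∈-insert-old R w sR , asv)

  twin-dominatesᵇ : ∀ R →
    not (w ∈B R) ∧ (not (meetsN (R [ w ]≔ true)) ∧ isDominating G-u (R [ w ]≔ true)) ≡ isDominating G-Nu-w R
  twin-dominatesᵇ R = reflects-≡
    (T-∧-reflects T-not (T-∧-reflects (not-meetsN-reflects (R [ w ]≔ true)) (dominates-reflects G-u (R [ w ]≔ true))))
    (dominates-reflects G-Nu-w R) (twin-dominates R)

  avoiding : ℕ → ℕ
  avoiding = sizedCount (λ W → not (u ∈B W) ∧ isDominating G W)

  count-G : ∀ k → sizedCount (isDominating G) k ≡ X*ℕ (sizedCount (isDominating G/u)) k +ℕ avoiding k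
  count-G k = trans (sizedCount-split (u ∈B_) (isDominating G) k)
    (cong (_+ℕ avoiding k) (trans (sizedCount-insert u (isDominating G) k)
                                  (X*ℕ-cong (sizedCount-cong contract-dominatesᵇ) k)))

  count-G-u : ∀ k → sizedCount (isDominating G-u) k ≡ avoiding k +ℕ X*ℕ (sizedCount (isDominating G-Nu-w)) k
  count-G-u k = trans (sizedCount-split meetsN (isDominating G-u) k)
    (cong₂ _+ℕ_ (sizedCount-cong meeting-dominatesᵇ k)
      (trans (sizedCount-cong missing-contains-twinᵇ k)
      (trans (sizedCount-insert w (λ W → not (meetsN W) ∧ isDominating G-u W) k)
             (X*ℕ-cong (sizedCount-cong twin-dominatesᵇ) k))))

difference-of-splits : ∀ {g h} c a d → g ≡ c +ℕ a → h ≡ a +ℕ d → + g ≡ (+ c + + h) - + d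
difference-of-splits c a d refl refl = begin
    + (c +ℕ a)                     ≡⟨ pos-+ c a ⟩
    + c + + a                      ≡⟨ solve 3 (λ c a d → c :+ a := (c :+ (a :+ d)) :- d) refl (+ c) (+ a) (+ d) ⟩
    (+ c + (+ a + + d)) - + d      ≡⟨ cong (λ z → (+ c + z) - + d) (sym (pos-+ a d)) ⟩
    (+ c + + (a +ℕ d)) - + d       ∎
  where
  open ≡-Reasoning
  open +-*-Solver

mainTheorem14 : (n : ℕ) (adjG : Fin n → Fin n → Bool)
    → (∀ x y → adjG x y ≡ adjG y x)
    → (∀ x → adjG x x ≡ false)
    → (u w : Fin n) → u ≢ w
    → (∀ v → adjG w v ≡ adjG u v)
    → let G = mkGraph (replicate n true) adjG in
      D G ≈P ((X* (D (contract G u)) +P D (delete G u)) -P X* (D (deleteClosedNbhdAnd G u w)))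
mainTheorem14 n adjG symA irr u w u≢w twin k = begin
    D G k
  ≡⟨ difference-of-splits _ (avoiding k) _ (count-G k) (count-G-u k) ⟩
    (+ X*ℕ (sizedCount (isDominating G/u)) k + D G-u k) - + X*ℕ (sizedCount (isDominating G-Nu-w)) k
  ≡⟨ sym (cong₂ (λ p q → (p + D G-u k) - q) (X*-pos _ k) (X*-pos _ k)) ⟩
    (X* (D G/u) k + D G-u k) - X* (D G-Nu-w) k
  ∎
  where
  open Twins adjG symA irr u w u≢w twin
  open ≡-Reasoning
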